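{- Let $m\ge 3$ be odd, $n\ge 4$ even, $n_0=n/2-1$ and $S=2(mn+1)$. Let $X=\{x_{i,j}\}$ be a bijection from the vertex set of $\mathcal{K}_{m,n}$ onto $\{1,\dots,mn\}$, and put $a_j=x_{1,j}+x_{1,j+1}$ for $1\le j\le n_0$. Then $X$ is a $C_4$-face-magic Klein bottle labeling of $\mathcal{K}_{m,n}$ if and only if all of the following hold: \begin{itemize} \item $x_{2i-1,j}+x_{2i-1,j+1}=a_j$ for all $1\le i\le (m+1)/2$, $1\le j\le n_0$; \item $x_{2i-1,n+1-j}=\tfrac12 S-x_{2i-1,j}$ for all $1\le i\le (m+1)/2$, $1\le j\le n/2$; \item $x_{2i,n-j}+x_{2i,n-j+1}=a_j$ for all $1\le i\le (m-1)/2$, $1\le j\le n_0$; \item $x_{2i,j}=\tfrac12 S-x_{2i,n+1-j}$ for all $1\le i\le (m-1)/2$, $1\le j\le n/2$. \end{itemize}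
   Context: The $m\times n$ Klein bottle grid graph $\mathcal{K}_{m,n}$ has vertex set $\{(i,j):1\le i\le m,\ 1\le j\le n\}$ and edges $(i,j)(i,j+1)$ for $1\le j\le n-1$; $(i,n)(i,1)$; $(i,j)(i+1,j)$ for $1\le i\le m-1$; and $(m,j)(1,n+1-j)$ for $1\le j\le n$. Its $4$-cycle faces in the natural Klein bottle embedding are, with column indices modulo $n$, $\{(i,j),(i,j+1),(i+1,j),(i+1,j+1)\}$ for $1\le i\le m-1$, $1\le j\le n$, and $\{(m,j),(m,j+1),(1,n+1-j),(1,n-j)\}$ for $1\le j\le n$. A $C_4$-face-magic Klein bottle labeling is a bijection $(i,j)\mapsto x_{i,j}$ onto $\{1,\dots,mn\}$ such that the label sum over every such face equals a common constant. -}

module Defs where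

open import Data.Nat using (ℕ; zero; suc; _+_; _*_; _∸_; _<?_; _≤_)
open import Data.Nat.DivMod using (_%_)
open import Data.Fin using (Fin; toℕ; fromℕ<)
open import Data.Product using (_×_; _,_; ∃)
open import Relation.Nullary using (yes; no)
open import Relation.Binary.PropositionalEquality using (_≡_)

-- A labeling is a map from the vertex set Fin m × Fin n (0-based internally)
-- to Fin (m * n); the label of a vertex is 1 + toℕ of the image, so labels lie in {1,…,mn}.
-- lab X i j is the label x_{i,j} with 1-based indices 1 ≤ i ≤ m, 1 ≤ j ≤ n
-- (it returns 0, an impossible label, outside that range; never used there).
lab : {m n : ℕ} → (Fin m × Fin n → Fin (m * n)) → ℕ → ℕ → ℕ
lab {m} {n} X (suc i) (suc j) with i <? m | j <? n
... | yes p | yes q = suc (toℕ (X (fromℕ< p , fromℕ< q)))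
... | _     | _     = 0
lab X _ _ = 0

-- column index reduced modulo n into {1,…,n}
wrap : ℕ → ℕ → ℕ
wrap zero c = c
wrap (suc k) c = suc ((c + k) % suc k)

FaceMagic : (m n : ℕ) → (Fin m × Fin n → Fin (m * n)) → Set
FaceMagic m n X = ∃ λ k →
  (∀ i j → 1 ≤ i → i ≤ m ∸ 1 → 1 ≤ j → j ≤ n →
     x i j + x i (wrap n (j + 1)) + x (i + 1) j + x (i + 1) (wrap n (j + 1)) ≡ k)
  × (∀ j → 1 ≤ j → j ≤ n →
     x m j + x m (wrap n (j + 1)) + x 1 (wrap n (n + 1 ∸ j)) + x 1 (wrap n (n ∸ j)) ≡ k)
  where x = lab X

-- Vertical faces make the horizontal pair sums x(i,j) + x(i,j+1) alternate down each
-- column: odd rows repeat row 1, even rows complement it to the magic constant k. The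
-- twisted faces then make the pair sums of every row complementary under j ↦ n − j,
-- which says that the opposite sums x(i,j) + x(i,n+1−j) satisfy o(j) + o(j+1) = k.
-- Being symmetric about the middle of the row, they are all k/2, and as the labels 1
-- and mn both occur, k/2 = mn + 1. Conversely, once all opposite sums are mn + 1 the
-- pair sums of a row are determined by those on its first half, which the conditions
-- fix, and every face sum becomes 2(mn + 1).
module Submission where

open import Data.Empty using (⊥-elim)
open import Data.Fin using (Fin; toℕ; fromℕ<)
open import Data.Fin.Properties using (toℕ<n; fromℕ<-toℕ; toℕ-fromℕ<)
open import Data.Nat using (ℕ; zero; suc; _+_; _*_; _∸_; _≤_; _<_; z≤n; s≤s; _<?_; _≤?_)
open import Data.Nat.DivMod using (_%_; _/_; [m+n]%n≡m%n; [m+kn]%n≡m%n; m<n⇒m%n≡m; m≡m%n+[m/n]*n; m*n/n≡m)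
open import Data.Nat.Properties
open import Data.Nat.Tactic.RingSolver using (solve-∀)
open import Data.Product using (_×_; _,_; proj₁; proj₂; ∃)
open import Data.Sum using (inj₁; inj₂)
open import Function.Bundles using (_⇔_; mk⇔)
open import Function.Definitions using (Bijective; Surjective)
open import Relation.Binary using (tri<; tri≈; tri>)
open import Relation.Binary.PropositionalEquality
open import Relation.Nullary using (yes; no)
open import Defs
open ≡-Reasoning

double-cancel-≤ : ∀ {a b} → a + a ≤ b + b → a ≤ b
double-cancel-≤ p = ≮⇒≥ (λ b<a → <⇒≱ (+-mono-< b<a b<a) p)

double-cancel-< : ∀ {a b} → a + a < b + b → a < b
double-cancel-< p = ≰⇒> (λ b≤a → <⇒≱ p (+-mono-≤ b≤a b≤a))

double-injective : ∀ {a b} → a + a ≡ b + b → a ≡ b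
double-injective e = ≤-antisym (double-cancel-≤ (≤-reflexive e)) (double-cancel-≤ (≤-reflexive (sym e)))

complement-chain : ∀ {a b c d k} → a + b ≡ k → c + d ≡ k → b + d ≡ k → a + c ≡ k
complement-chain {a} {b} {c} {d} {k} ab cd bd = +-cancelʳ-≡ k (a + c) k (begin
  (a + c) + k        ≡⟨ cong ((a + c) +_) (sym bd) ⟩
  (a + c) + (b + d)  ≡⟨ shuffle a c b d ⟩
  (a + b) + (c + d)  ≡⟨ cong₂ _+_ ab cd ⟩
  k + k              ∎)
  where
  shuffle : ∀ a c b d → (a + c) + (b + d) ≡ (a + b) + (c + d)
  shuffle = solve-∀

data Parity : ℕ → Set where
  even : ∀ q → Parity (q + q)
  odd  : ∀ q → Parity (suc (q + q))

parity : ∀ i → Parity i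
parity zero = even 0
parity (suc i) with parity i
... | even q = odd q
... | odd q  = subst Parity (cong suc (+-suc q q)) (even (suc q))

module _ {r : ℕ → ℕ} {k B : ℕ} (step : ∀ i → i < B → r i + r (suc i) ≡ k) where

  alternating-even : ∀ q → q + q ≤ B → r (q + q) ≡ r 0
  alternating-odd  : ∀ q → suc (q + q) ≤ B → r (suc (q + q)) + r 0 ≡ k

  alternating-even zero _ = refl
  alternating-even (suc q) p rewrite +-suc q q =
    +-cancelˡ-≡ (r (suc (q + q))) _ _
      (trans (step (suc (q + q)) p) (sym (alternating-odd q (<⇒≤ p))))

  alternating-odd q p =
    trans (cong (r (suc (q + q)) +_) (sym (alternating-even q (<⇒≤ p))))
          (trans (+-comm (r (suc (q + q))) (r (q + q))) (step (q + q) p))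

alternating-step : ∀ {r : ℕ → ℕ} {k B} →
  (∀ q → q + q ≤ B → r (q + q) ≡ r 0) →
  (∀ q → suc (q + q) ≤ B → r (suc (q + q)) + r 0 ≡ k) →
  ∀ i → i < B → r i + r (suc i) ≡ k
alternating-step {r} {k} {B} even-terms odd-terms i i<B with parity i
... | even q = trans (cong (_+ r (suc (q + q))) (even-terms q (<⇒≤ i<B)))
                     (trans (+-comm (r 0) _) (odd-terms q i<B))
... | odd q  = trans (cong (r (suc (q + q)) +_) next) (odd-terms q (<⇒≤ i<B))
  where
  next : r (suc (suc (q + q))) ≡ r 0
  next = subst (λ t → r (suc t) ≡ r 0) (+-suc q q)
           (even-terms (suc q) (subst (λ t → suc t ≤ B) (sym (+-suc q q)) i<B))

module Columns (n h : ℕ) (n≡h+h : n ≡ h + h) (1≤h : 1 ≤ h) where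

  h<n : h < n
  h<n = subst (h <_) (sym n≡h+h) (m<m+n h 1≤h)

  n∸h≡h : n ∸ h ≡ h
  n∸h≡h = trans (cong (_∸ h) n≡h+h) (m+n∸m≡n h h)

  reflect-<-half : ∀ {j} → h < j → j ≤ n → n ∸ j < h
  reflect-<-half h<j j≤n = subst (_ <_) n∸h≡h (∸-monoʳ-< h<j j≤n)

  mirror-suc : ∀ j → n + 1 ∸ suc j ≡ n ∸ j
  mirror-suc j = cong (_∸ suc j) (+-comm n 1)

  reflect-suc : ∀ {j} → j ≤ n → n ∸ j + 1 ≡ n + 1 ∸ j
  reflect-suc j≤n = sym (+-∸-comm 1 j≤n)

  mirror-involutive : ∀ {j} → j ≤ n → n + 1 ∸ (n + 1 ∸ j) ≡ j
  mirror-involutive j≤n = m∸[m∸n]≡n (≤-trans j≤n (m≤m+n _ 1))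

  mirror-pos : ∀ {j} → j ≤ n → 1 ≤ n + 1 ∸ j
  mirror-pos j≤n = subst (1 ≤_) (trans (+-comm 1 _) (reflect-suc j≤n)) (s≤s z≤n)

  mirror-≤ : ∀ {j} → 1 ≤ j → n + 1 ∸ j ≤ n
  mirror-≤ {suc j} _ = subst (_≤ n) (sym (mirror-suc j)) (m∸n≤m n j)

  mirror-half : ∀ {j} → h < j → n + 1 ∸ j ≤ h
  mirror-half h<j = ≤-trans (∸-monoʳ-≤ (n + 1) h<j) (≤-reflexive (trans (mirror-suc h) n∸h≡h))

  mirror-half-suc : n + 1 ∸ h ≡ suc h
  mirror-half-suc = trans (sym (reflect-suc (<⇒≤ h<n))) (trans (cong (_+ 1) n∸h≡h) (+-comm h 1))

  above-half-pos : ∀ {j} → h < j → 1 ≤ j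
  above-half-pos h<j = ≤-trans 1≤h (<⇒≤ h<j)

  below-half : ∀ {j} → j ≤ h ∸ 1 → j < h
  below-half j≤h-1 = subst (_ ≤_) (trans (+-comm 1 (h ∸ 1)) (m∸n+n≡m 1≤h)) (s≤s j≤h-1)

  Complementary : ℕ → (ℕ → ℕ) → Set
  Complementary K f = ∀ j → 1 ≤ j → j < n → f j + f (n ∸ j) ≡ K

  Symmetric : (ℕ → ℕ) → Set
  Symmetric f = ∀ j → j ≤ n → f (n + 1 ∸ j) ≡ f j

  by-halves : (P : ℕ → Set) → (∀ j → 1 ≤ j → j < h → P j) → P h →
    (∀ j → h < j → j < n → P (n ∸ j) → P j) → P n → ∀ j → 1 ≤ j → j ≤ n → P j
  by-halves P low mid high top j 1≤j j≤n with <-cmp j h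
  ... | tri< j<h _ _ = low j 1≤j j<h
  ... | tri≈ _ refl _ = mid
  ... | tri> _ _ h<j with <-cmp j n
  ...   | tri< j<n _ _ = high j h<j j<n (low (n ∸ j) (m<n⇒0<n∸m j<n) (reflect-<-half h<j j≤n))
  ...   | tri≈ _ refl _ = top
  ...   | tri> _ _ n<j = ⊥-elim (<⇒≱ n<j j≤n)

  complementary-half : ∀ {C f} → Complementary (C + C) f → f h ≡ C
  complementary-half {C} {f} cf =
    double-injective (subst (λ t → f h + f t ≡ C + C) n∸h≡h (cf h 1≤h h<n))

  module _ {C : ℕ} {f g : ℕ → ℕ} (cf : Complementary (C + C) f) (cg : Complementary (C + C) g) where

    complementary-agree : f n ≡ g n →
      (∀ j → 1 ≤ j → j < h → f j ≡ g j) → ∀ j → 1 ≤ j → j ≤ n → f j ≡ g j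
    complementary-agree top low = by-halves (λ j → f j ≡ g j) low
      (trans (complementary-half {C} {f} cf) (sym (complementary-half {C} {g} cg)))
      (λ j h<j j<n f≡g → +-cancelʳ-≡ (f (n ∸ j)) (f j) (g j)
         (trans (cf j (above-half-pos h<j) j<n)
                (sym (trans (cong (g j +_) f≡g) (cg j (above-half-pos h<j) j<n)))))
      top

    complementary-opposite : f n + g n ≡ C + C →
      (∀ j → 1 ≤ j → j < h → f j + g j ≡ C + C) → ∀ j → 1 ≤ j → j ≤ n → f j + g j ≡ C + C
    complementary-opposite top low = by-halves (λ j → f j + g j ≡ C + C) low
      (cong₂ _+_ (complementary-half {C} {f} cf) (complementary-half {C} {g} cg))
      (λ j h<j j<n → complement-chain {f j} {f (n ∸ j)} {g j} {g (n ∸ j)}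
         (cf j (above-half-pos h<j) j<n) (cg j (above-half-pos h<j) j<n))
      top

  symmetric-extend : ∀ {f c} → Symmetric f → (∀ j → 1 ≤ j → j ≤ h → f j ≡ c) →
    ∀ j → 1 ≤ j → j ≤ n → f j ≡ c
  symmetric-extend {f} sf low j 1≤j j≤n with j ≤? h
  ... | yes j≤h = low j 1≤j j≤h
  ... | no j≰h  = trans (sym (sf j j≤n)) (low (n + 1 ∸ j) (mirror-pos j≤n) (mirror-half (≰⇒> j≰h)))

  symmetric-double : ∀ {f k} → Symmetric f → (∀ j → 1 ≤ j → j < n → f j + f (suc j) ≡ k) →
    ∀ j → 1 ≤ j → j ≤ n → f j + f j ≡ k
  symmetric-double {f} {k} sf step j 1≤j j≤n =
    subst (λ t → t + t ≡ k) (sym (symmetric-extend sf from-below j 1≤j j≤n)) middle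
    where
    middle : f h + f h ≡ k
    middle = subst (λ t → f h + t ≡ k) (trans (cong f (sym mirror-half-suc)) (sf h (<⇒≤ h<n)))
               (step h 1≤h h<n)
    descend : ∀ d j → j + d ≡ h → 1 ≤ j → f j ≡ f h
    descend zero j j≡h _ = cong f (trans (sym (+-identityʳ j)) j≡h)
    descend (suc d) j j+1+d≡h 1≤j = +-cancelʳ-≡ (f h) (f j) (f h) (begin
      f j + f h        ≡⟨ cong (f j +_) (sym (descend d (suc j) (trans (sym (+-suc j d)) j+1+d≡h) (s≤s z≤n))) ⟩
      f j + f (suc j)  ≡⟨ step j 1≤j (<-trans (subst (j <_) j+1+d≡h (m<m+n j (s≤s z≤n))) h<n) ⟩
      k                ≡⟨ sym middle ⟩
      f h + f h        ∎)
    from-below : ∀ j → 1 ≤ j → j ≤ h → f j ≡ f h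
    from-below j 1≤j j≤h = descend (h ∸ j) j (m+[n∸m]≡n j≤h) 1≤j

wrap-id : ∀ {n c} → 1 ≤ c → c ≤ n → wrap n c ≡ c
wrap-id {suc k} {suc c} _ (s≤s c≤k) = cong suc (begin
  (suc c + k) % suc k  ≡⟨ cong (_% suc k) (sym (+-suc c k)) ⟩
  (c + suc k) % suc k  ≡⟨ [m+n]%n≡m%n c (suc k) ⟩
  c % suc k            ≡⟨ m<n⇒m%n≡m (s≤s c≤k) ⟩
  c                    ∎)

wrap-n+1 : ∀ {n} → 1 ≤ n → wrap n (n + 1) ≡ 1
wrap-n+1 {suc k} _ = cong suc (trans (cong (_% suc k) (shape k)) ([m+kn]%n≡m%n 0 2 (suc k)))
  where
  shape : ∀ k → suc k + 1 + k ≡ 0 + 2 * suc k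
  shape = solve-∀

wrap-0 : ∀ {n} → 1 ≤ n → wrap n 0 ≡ n
wrap-0 {suc k} _ = cong suc (m<n⇒m%n≡m ≤-refl)

module _ {m n : ℕ} (X : Fin m × Fin n → Fin (m * n)) where

  lab-bounds : ∀ {i j} → 1 ≤ i → i ≤ m → 1 ≤ j → j ≤ n → 1 ≤ lab X i j × lab X i j ≤ m * n
  lab-bounds {suc i} {suc j} _ i≤m _ j≤n with i <? m | j <? n
  ... | yes _ | yes _  = s≤s z≤n , toℕ<n _
  ... | no i≮m | _     = ⊥-elim (i≮m i≤m)
  ... | yes _ | no j≮n = ⊥-elim (j≮n j≤n)

  lab-toℕ : ∀ a b → lab X (suc (toℕ a)) (suc (toℕ b)) ≡ suc (toℕ (X (a , b)))
  lab-toℕ a b with toℕ a <? m | toℕ b <? n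
  ... | yes a<m | yes b<n = cong (λ v → suc (toℕ (X v))) (cong₂ _,_ (fromℕ<-toℕ a a<m) (fromℕ<-toℕ b b<n))
  ... | no a≮m | _        = ⊥-elim (a≮m (toℕ<n a))
  ... | yes _ | no b≮n    = ⊥-elim (b≮n (toℕ<n b))

  lab-surjective : Surjective _≡_ _≡_ X → ∀ {t} → t < m * n →
    ∃ λ i → ∃ λ j → 1 ≤ i × i ≤ m × 1 ≤ j × j ≤ n × lab X i j ≡ suc t
  lab-surjective surj {t} t<mn with surj (fromℕ< t<mn)
  ... | (a , b) , hit = suc (toℕ a) , suc (toℕ b) , s≤s z≤n , toℕ<n a , s≤s z≤n , toℕ<n b ,
        trans (lab-toℕ a b) (cong suc (trans (cong toℕ (hit refl)) (toℕ-fromℕ< t<mn)))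

odd-index : ∀ q → 2 * suc q ∸ 1 ≡ suc (q + q)
odd-index q = trans (cong (q +_) (+-identityʳ (suc q))) (+-suc q q)

even-index : ∀ q → 2 * suc q ≡ suc (suc (q + q))
even-index q = cong suc (odd-index q)

module Grid (m n g h : ℕ) (m≡1+2g : m ≡ suc (g + g)) (n≡h+h : n ≡ h + h) (1≤h : 1 ≤ h)
            (X : Fin m × Fin n → Fin (m * n)) where

  open Columns n h n≡h+h 1≤h

  1≤n : 1 ≤ n
  1≤n = ≤-trans 1≤h (<⇒≤ h<n)

  1≤m : 1 ≤ m
  1≤m = subst (1 ≤_) (sym m≡1+2g) (s≤s z≤n)

  odd-row-≤ : ∀ {q} → q ≤ g → suc (q + q) ≤ m
  odd-row-≤ q≤g = subst (_ ≤_) (sym m≡1+2g) (s≤s (+-mono-≤ q≤g q≤g))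

  even-row-≤ : ∀ {q} → q < g → suc (suc (q + q)) ≤ m
  even-row-≤ q<g = subst (_ ≤_) (sym m≡1+2g) (s≤s (+-mono-≤ q<g (<⇒≤ q<g)))

  x : ℕ → ℕ → ℕ
  x = lab X

  C : ℕ
  C = m * n + 1

  adjSum oppSum : ℕ → ℕ → ℕ
  adjSum i j = x i j + x i (wrap n (j + 1))
  oppSum i j = x i j + x i (n + 1 ∸ j)

  twistSum : ℕ → ℕ
  twistSum j = x 1 (wrap n (n + 1 ∸ j)) + x 1 (wrap n (n ∸ j))

  x≤C : ∀ {i j} → 1 ≤ i → i ≤ m → 1 ≤ j → j ≤ n → x i j ≤ C
  x≤C 1≤i i≤m 1≤j j≤n = ≤-trans (proj₂ (lab-bounds X 1≤i i≤m 1≤j j≤n)) (m≤m+n (m * n) 1)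

  adjSum-inner : ∀ i {j} → j < n → adjSum i j ≡ x i j + x i (j + 1)
  adjSum-inner i {j} j<n =
    cong (λ c → x i j + x i c) (wrap-id (m≤n+m 1 j) (subst (_≤ n) (+-comm 1 j) j<n))

  adjSum-reflected : ∀ i {j} → 1 ≤ j → j ≤ n → adjSum i (n ∸ j) ≡ x i (n ∸ j) + x i (n + 1 ∸ j)
  adjSum-reflected i {j} 1≤j j≤n =
    trans (adjSum-inner i (∸-monoʳ-< 1≤j j≤n)) (cong (λ c → x i (n ∸ j) + x i c) (reflect-suc j≤n))

  adjSum-last : ∀ i → adjSum i n ≡ oppSum i 1
  adjSum-last i = begin
    x i n + x i (wrap n (n + 1))  ≡⟨ cong (λ c → x i n + x i c) (wrap-n+1 1≤n) ⟩
    x i n + x i 1                 ≡⟨ +-comm (x i n) (x i 1) ⟩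
    x i 1 + x i n                 ≡⟨ cong (λ c → x i 1 + x i c) (sym (m+n∸n≡m n 1)) ⟩
    oppSum i 1                    ∎

  oppSum-symmetric : ∀ i → Symmetric (oppSum i)
  oppSum-symmetric i j j≤n =
    trans (cong (λ c → x i (n + 1 ∸ j) + x i c) (mirror-involutive j≤n)) (+-comm (x i (n + 1 ∸ j)) (x i j))

  oppSum-step : ∀ i {j} → 1 ≤ j → j < n →
    oppSum i j + oppSum i (suc j) ≡ adjSum i j + adjSum i (n ∸ j)
  oppSum-step i {j} 1≤j j<n = begin
    (x i j + x i (n + 1 ∸ j)) + (x i (suc j) + x i (n + 1 ∸ suc j))
      ≡⟨ cong₂ (λ a b → (x i j + x i (n + 1 ∸ j)) + (x i a + x i b)) (+-comm 1 j) (mirror-suc j) ⟩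
    (x i j + x i (n + 1 ∸ j)) + (x i (j + 1) + x i (n ∸ j))
      ≡⟨ shuffle (x i j) (x i (n + 1 ∸ j)) (x i (j + 1)) (x i (n ∸ j)) ⟩
    (x i j + x i (j + 1)) + (x i (n ∸ j) + x i (n + 1 ∸ j))
      ≡⟨ sym (cong₂ _+_ (adjSum-inner i j<n) (adjSum-reflected i 1≤j (<⇒≤ j<n))) ⟩
    adjSum i j + adjSum i (n ∸ j)
      ∎
    where
    shuffle : ∀ a b c d → (a + b) + (c + d) ≡ (a + c) + (d + b)
    shuffle = solve-∀

  twistSum-inner : ∀ {j} → 1 ≤ j → j < n → twistSum j ≡ adjSum 1 (n ∸ j)
  twistSum-inner {j} 1≤j j<n = begin
    x 1 (wrap n (n + 1 ∸ j)) + x 1 (wrap n (n ∸ j))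
      ≡⟨ cong₂ (λ a b → x 1 a + x 1 b) (wrap-id (mirror-pos (<⇒≤ j<n)) (mirror-≤ 1≤j))
                                       (wrap-id (m<n⇒0<n∸m j<n) (m∸n≤m n j)) ⟩
    x 1 (n + 1 ∸ j) + x 1 (n ∸ j)
      ≡⟨ +-comm (x 1 (n + 1 ∸ j)) (x 1 (n ∸ j)) ⟩
    x 1 (n ∸ j) + x 1 (n + 1 ∸ j)
      ≡⟨ sym (adjSum-reflected 1 1≤j (<⇒≤ j<n)) ⟩
    adjSum 1 (n ∸ j)
      ∎

  twistSum-last : twistSum n ≡ oppSum 1 1
  twistSum-last = cong₂ (λ a b → x 1 a + x 1 b)
    (trans (cong (wrap n) (m+n∸m≡n n 1)) (wrap-id ≤-refl 1≤n))
    (trans (cong (wrap n) (n∸n≡0 n)) (trans (wrap-0 1≤n) (sym (m+n∸n≡m n 1))))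

  Vertical Twisted : ℕ → Set
  Vertical k = ∀ i j → 1 ≤ i → i < m → 1 ≤ j → j ≤ n → adjSum i j + adjSum (suc i) j ≡ k
  Twisted k = ∀ j → 1 ≤ j → j ≤ n → adjSum m j + twistSum j ≡ k

  faceMagic⇒ : FaceMagic m n X → ∃ λ k → Vertical k × Twisted k
  faceMagic⇒ (k , square , twist) = k , vertical , twisted
    where
    vertical : Vertical k
    vertical i j 1≤i i<m 1≤j j≤n = trans (sym (+-assoc (adjSum i j) _ _))
      (subst (λ t → adjSum i j + x t j + x t (wrap n (j + 1)) ≡ k) (+-comm i 1)
        (square i j 1≤i (∸-monoˡ-≤ 1 i<m) 1≤j j≤n))
    twisted : Twisted k
    twisted j 1≤j j≤n = trans (sym (+-assoc (adjSum m j) _ _)) (twist j 1≤j j≤n)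

  faceMagic⇐ : ∀ {k} → Vertical k → Twisted k → FaceMagic m n X
  faceMagic⇐ {k} vertical twisted = k , square , twist
    where
    square : ∀ i j → 1 ≤ i → i ≤ m ∸ 1 → 1 ≤ j → j ≤ n →
      x i j + x i (wrap n (j + 1)) + x (i + 1) j + x (i + 1) (wrap n (j + 1)) ≡ k
    square i j 1≤i i≤m-1 1≤j j≤n =
      subst (λ t → adjSum i j + x t j + x t (wrap n (j + 1)) ≡ k) (+-comm 1 i)
        (trans (+-assoc (adjSum i j) _ _)
          (vertical i j 1≤i (subst (λ t → i ≤ t ∸ 1 → i < t) (sym m≡1+2g) s≤s i≤m-1) 1≤j j≤n))
    twist : ∀ j → 1 ≤ j → j ≤ n →
      x m j + x m (wrap n (j + 1)) + x 1 (wrap n (n + 1 ∸ j)) + x 1 (wrap n (n ∸ j)) ≡ k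
    twist j 1≤j j≤n = trans (+-assoc (adjSum m j) _ _) (twisted j 1≤j j≤n)

  by-row-parity : (P : ℕ → Set) → (∀ q → q ≤ g → P (suc (q + q))) →
    (∀ q → q < g → P (suc (suc (q + q)))) → ∀ i → 1 ≤ i → i ≤ m → P i
  by-row-parity P oddRow evenRow (suc i) _ i<m with parity i | subst (suc i ≤_) m≡1+2g i<m
  ... | even q | s≤s q+q≤g+g  = oddRow q (double-cancel-≤ q+q≤g+g)
  ... | odd q  | s≤s q+q<g+g  = evenRow q (double-cancel-< q+q<g+g)

  OddAdjacent OddMirror EvenAdjacent EvenMirror : ℕ → Set
  OddAdjacent u = ∀ i j → 1 ≤ i → i ≤ u → 1 ≤ j → j ≤ h ∸ 1 →
    x (2 * i ∸ 1) j + x (2 * i ∸ 1) (j + 1) ≡ x 1 j + x 1 (j + 1)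
  OddMirror u = ∀ i j → 1 ≤ i → i ≤ u → 1 ≤ j → j ≤ h →
    x (2 * i ∸ 1) (n + 1 ∸ j) ≡ C ∸ x (2 * i ∸ 1) j
  EvenAdjacent v = ∀ i j → 1 ≤ i → i ≤ v → 1 ≤ j → j ≤ h ∸ 1 →
    x (2 * i) (n ∸ j) + x (2 * i) (n ∸ j + 1) ≡ x 1 j + x 1 (j + 1)
  EvenMirror v = ∀ i j → 1 ≤ i → i ≤ v → 1 ≤ j → j ≤ h →
    x (2 * i) j ≡ C ∸ x (2 * i) (n + 1 ∸ j)

  Conditions : ℕ → ℕ → Set
  Conditions u v = OddAdjacent u × OddMirror u × EvenAdjacent v × EvenMirror v

  0<mn : 0 < m * n
  0<mn = *-mono-≤ 1≤m 1≤n

  -- The labels 1 and mn both occur: the opposite sum through 1 is at most 1 + mn,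
  -- the one through mn at least mn + 1.
  oppSum-forced : Surjective _≡_ _≡_ X → ∀ {s} →
    (∀ i j → 1 ≤ i → i ≤ m → 1 ≤ j → j ≤ n → oppSum i j ≡ s) → s ≡ C
  oppSum-forced surj {s} oppSum≡s
    with lab-surjective X surj 0<mn | lab-surjective X surj (∸-monoʳ-< ≤-refl 0<mn)
  ... | i₀ , j₀ , 1≤i₀ , i₀≤m , 1≤j₀ , j₀≤n , x₀≡1
      | i₁ , j₁ , 1≤i₁ , i₁≤m , 1≤j₁ , j₁≤n , x₁≡mn =
    ≤-antisym upper lower
    where
    partner-bounds : ∀ {i j} → 1 ≤ i → i ≤ m → 1 ≤ j → j ≤ n →
      1 ≤ x i (n + 1 ∸ j) × x i (n + 1 ∸ j) ≤ m * n
    partner-bounds 1≤i i≤m 1≤j j≤n = lab-bounds X 1≤i i≤m (mirror-pos j≤n) (mirror-≤ 1≤j)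
    upper : s ≤ C
    upper = subst₂ _≤_ (trans (cong (_+ x i₀ (n + 1 ∸ j₀)) (sym x₀≡1)) (oppSum≡s i₀ j₀ 1≤i₀ i₀≤m 1≤j₀ j₀≤n))
      (+-comm 1 (m * n)) (s≤s (proj₂ (partner-bounds 1≤i₀ i₀≤m 1≤j₀ j₀≤n)))
    lower : C ≤ s
    lower = subst (C ≤_)
      (trans (cong (_+ x i₁ (n + 1 ∸ j₁)) (sym (trans x₁≡mn (trans (+-comm 1 _) (m∸n+n≡m 0<mn)))))
             (oppSum≡s i₁ j₁ 1≤i₁ i₁≤m 1≤j₁ j₁≤n))
      (+-monoʳ-≤ (m * n) (proj₁ (partner-bounds 1≤i₁ i₁≤m 1≤j₁ j₁≤n)))

  module Forward {k : ℕ} (vertical : Vertical k) (twisted : Twisted k) where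

    column-step : ∀ {j} → 1 ≤ j → j ≤ n → ∀ i → i < g + g →
      adjSum (suc i) j + adjSum (suc (suc i)) j ≡ k
    column-step {j} 1≤j j≤n i i<2g =
      vertical (suc i) j (s≤s z≤n) (subst (suc i <_) (sym m≡1+2g) (s≤s i<2g)) 1≤j j≤n

    odd-row : ∀ {q j} → q ≤ g → 1 ≤ j → j ≤ n → adjSum (suc (q + q)) j ≡ adjSum 1 j
    odd-row {q} {j} q≤g 1≤j j≤n =
      alternating-even {r = λ i → adjSum (suc i) j} (column-step 1≤j j≤n) q (+-mono-≤ q≤g q≤g)

    even-row : ∀ {q j} → q < g → 1 ≤ j → j ≤ n → adjSum (suc (suc (q + q))) j + adjSum 1 j ≡ k
    even-row {q} {j} q<g 1≤j j≤n =
      alternating-odd {r = λ i → adjSum (suc i) j} (column-step 1≤j j≤n) q (+-mono-≤ q<g (<⇒≤ q<g))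

    first-row-complementary : Complementary k (adjSum 1)
    first-row-complementary j 1≤j j<n = begin
      adjSum 1 j + adjSum 1 (n ∸ j)  ≡⟨ cong₂ _+_ (sym last-row) (sym (twistSum-inner 1≤j j<n)) ⟩
      adjSum m j + twistSum j        ≡⟨ twisted j 1≤j (<⇒≤ j<n) ⟩
      k                              ∎
      where
      last-row : adjSum m j ≡ adjSum 1 j
      last-row = subst (λ t → adjSum t j ≡ adjSum 1 j) (sym m≡1+2g) (odd-row ≤-refl 1≤j (<⇒≤ j<n))

    row-complementary : ∀ i → 1 ≤ i → i ≤ m → Complementary k (adjSum i)
    row-complementary = by-row-parity (λ i → Complementary k (adjSum i))
      (λ q q≤g j 1≤j j<n → trans
        (cong₂ _+_ (odd-row q≤g 1≤j (<⇒≤ j<n)) (odd-row q≤g (m<n⇒0<n∸m j<n) (m∸n≤m n j)))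
        (first-row-complementary j 1≤j j<n))
      (λ q q<g j 1≤j j<n → complement-chain {adjSum (suc (suc (q + q))) j} {adjSum 1 j}
        (even-row q<g 1≤j (<⇒≤ j<n)) (even-row q<g (m<n⇒0<n∸m j<n) (m∸n≤m n j))
        (first-row-complementary j 1≤j j<n))

    oppSum-double : ∀ i j → 1 ≤ i → i ≤ m → 1 ≤ j → j ≤ n → oppSum i j + oppSum i j ≡ k
    oppSum-double i j 1≤i i≤m = symmetric-double (oppSum-symmetric i)
      (λ j 1≤j j<n → trans (oppSum-step i 1≤j j<n) (row-complementary i 1≤i i≤m j 1≤j j<n)) j

    oppSum≡C : Surjective _≡_ _≡_ X → ∀ i j → 1 ≤ i → i ≤ m → 1 ≤ j → j ≤ n → oppSum i j ≡ C
    oppSum≡C surj i j 1≤i i≤m 1≤j j≤n = trans (same i j 1≤i i≤m 1≤j j≤n) (oppSum-forced surj same)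
      where
      same : ∀ i j → 1 ≤ i → i ≤ m → 1 ≤ j → j ≤ n → oppSum i j ≡ oppSum 1 1
      same i j 1≤i i≤m 1≤j j≤n = double-injective
        (trans (oppSum-double i j 1≤i i≤m 1≤j j≤n) (sym (oppSum-double 1 1 ≤-refl 1≤m ≤-refl 1≤n)))

    conditions : Surjective _≡_ _≡_ X → Conditions (suc g) g
    conditions surj = odd-adjacent , odd-mirror , even-adjacent , even-mirror
      where
      odd-adjacent : OddAdjacent (suc g)
      odd-adjacent (suc q) j _ (s≤s q≤g) 1≤j j≤h-1 =
        subst (λ t → x t j + x t (j + 1) ≡ x 1 j + x 1 (j + 1)) (sym (odd-index q)) (begin
          x o j + x o (j + 1)  ≡⟨ sym (adjSum-inner o j<n) ⟩
          adjSum o j           ≡⟨ odd-row q≤g 1≤j (<⇒≤ j<n) ⟩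
          adjSum 1 j           ≡⟨ adjSum-inner 1 j<n ⟩
          x 1 j + x 1 (j + 1)  ∎)
        where
        o = suc (q + q)
        j<n = <-trans (below-half j≤h-1) h<n
      odd-mirror : OddMirror (suc g)
      odd-mirror (suc q) j _ (s≤s q≤g) 1≤j j≤h =
        subst (λ t → x t (n + 1 ∸ j) ≡ C ∸ x t j) (sym (odd-index q)) (sym (begin
          C ∸ x o j           ≡⟨ cong (_∸ x o j) (sym (oppSum≡C surj o j (s≤s z≤n) o≤m 1≤j j≤n)) ⟩
          oppSum o j ∸ x o j  ≡⟨ m+n∸m≡n (x o j) _ ⟩
          x o (n + 1 ∸ j)     ∎))
        where
        o = suc (q + q)
        o≤m = odd-row-≤ q≤g
        j≤n = ≤-trans j≤h (<⇒≤ h<n)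
      even-adjacent : EvenAdjacent g
      even-adjacent (suc q) j _ q<g 1≤j j≤h-1 =
        subst (λ t → x t (n ∸ j) + x t (n ∸ j + 1) ≡ x 1 j + x 1 (j + 1)) (sym (even-index q)) (begin
          x e (n ∸ j) + x e (n ∸ j + 1)  ≡⟨ sym (adjSum-inner e (∸-monoʳ-< 1≤j (<⇒≤ j<n))) ⟩
          adjSum e (n ∸ j)               ≡⟨ +-cancelʳ-≡ (adjSum 1 (n ∸ j)) _ _ (trans
                                              (even-row q<g (m<n⇒0<n∸m j<n) (m∸n≤m n j))
                                              (sym (first-row-complementary j 1≤j j<n))) ⟩
          adjSum 1 j                     ≡⟨ adjSum-inner 1 j<n ⟩
          x 1 j + x 1 (j + 1)            ∎)
        where
        e = suc (suc (q + q))
        j<n = <-trans (below-half j≤h-1) h<n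
      even-mirror : EvenMirror g
      even-mirror (suc q) j _ q<g 1≤j j≤h =
        subst (λ t → x t j ≡ C ∸ x t (n + 1 ∸ j)) (sym (even-index q)) (sym (begin
          C ∸ x e (n + 1 ∸ j)           ≡⟨ cong (_∸ x e (n + 1 ∸ j)) (sym (oppSum≡C surj e j (s≤s z≤n) e≤m 1≤j j≤n)) ⟩
          oppSum e j ∸ x e (n + 1 ∸ j)  ≡⟨ m+n∸n≡m (x e j) (x e (n + 1 ∸ j)) ⟩
          x e j                         ∎))
        where
        e = suc (suc (q + q))
        e≤m = even-row-≤ q<g
        j≤n = ≤-trans j≤h (<⇒≤ h<n)

  module Backward (odd-adjacent : OddAdjacent (suc g)) (odd-mirror : OddMirror (suc g))
                  (even-adjacent : EvenAdjacent g) (even-mirror : EvenMirror g) where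

    oppSum-odd : ∀ q → q ≤ g → ∀ j → 1 ≤ j → j ≤ h → oppSum (suc (q + q)) j ≡ C
    oppSum-odd q q≤g j 1≤j j≤h = begin
      x o j + x o (n + 1 ∸ j)  ≡⟨ cong (x o j +_) mirror ⟩
      x o j + (C ∸ x o j)      ≡⟨ m+[n∸m]≡n (x≤C (s≤s z≤n) (odd-row-≤ q≤g) 1≤j j≤n) ⟩
      C                        ∎
      where
      o = suc (q + q)
      j≤n = ≤-trans j≤h (<⇒≤ h<n)
      mirror : x o (n + 1 ∸ j) ≡ C ∸ x o j
      mirror = subst (λ t → x t (n + 1 ∸ j) ≡ C ∸ x t j) (odd-index q)
                 (odd-mirror (suc q) j (s≤s z≤n) (s≤s q≤g) 1≤j j≤h)

    oppSum-even : ∀ q → q < g → ∀ j → 1 ≤ j → j ≤ h → oppSum (suc (suc (q + q))) j ≡ C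
    oppSum-even q q<g j 1≤j j≤h = begin
      x e j + x e (n + 1 ∸ j)          ≡⟨ cong (_+ x e (n + 1 ∸ j)) mirror ⟩
      C ∸ x e (n + 1 ∸ j) + x e (n + 1 ∸ j)
        ≡⟨ m∸n+n≡m (x≤C (s≤s z≤n) (even-row-≤ q<g) (mirror-pos j≤n) (mirror-≤ 1≤j)) ⟩
      C                                ∎
      where
      e = suc (suc (q + q))
      j≤n = ≤-trans j≤h (<⇒≤ h<n)
      mirror : x e j ≡ C ∸ x e (n + 1 ∸ j)
      mirror = subst (λ t → x t j ≡ C ∸ x t (n + 1 ∸ j)) (even-index q)
                 (even-mirror (suc q) j (s≤s z≤n) q<g 1≤j j≤h)

    oppSum≡C : ∀ i j → 1 ≤ i → i ≤ m → 1 ≤ j → j ≤ n → oppSum i j ≡ C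
    oppSum≡C i j 1≤i i≤m = symmetric-extend (oppSum-symmetric i)
      (by-row-parity (λ i → ∀ j → 1 ≤ j → j ≤ h → oppSum i j ≡ C) oppSum-odd oppSum-even i 1≤i i≤m) j

    row-complementary : ∀ i → 1 ≤ i → i ≤ m → Complementary (C + C) (adjSum i)
    row-complementary i 1≤i i≤m j 1≤j j<n = trans (sym (oppSum-step i 1≤j j<n))
      (cong₂ _+_ (oppSum≡C i j 1≤i i≤m 1≤j (<⇒≤ j<n)) (oppSum≡C i (suc j) 1≤i i≤m (s≤s z≤n) j<n))

    adjSum-last≡C : ∀ i → 1 ≤ i → i ≤ m → adjSum i n ≡ C
    adjSum-last≡C i 1≤i i≤m = trans (adjSum-last i) (oppSum≡C i 1 1≤i i≤m ≤-refl 1≤n)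

    odd-row : ∀ q j → q ≤ g → 1 ≤ j → j ≤ n → adjSum (suc (q + q)) j ≡ adjSum 1 j
    odd-row q j q≤g = complementary-agree {C} {adjSum o} {adjSum 1}
      (row-complementary o (s≤s z≤n) (odd-row-≤ q≤g)) (row-complementary 1 ≤-refl 1≤m)
      (trans (adjSum-last≡C o (s≤s z≤n) (odd-row-≤ q≤g)) (sym (adjSum-last≡C 1 ≤-refl 1≤m))) below j
      where
      o = suc (q + q)
      below : ∀ j → 1 ≤ j → j < h → adjSum o j ≡ adjSum 1 j
      below j 1≤j j<h = begin
        adjSum o j           ≡⟨ adjSum-inner o j<n ⟩
        x o j + x o (j + 1)  ≡⟨ subst (λ t → x t j + x t (j + 1) ≡ x 1 j + x 1 (j + 1)) (odd-index q)
                                 (odd-adjacent (suc q) j (s≤s z≤n) (s≤s q≤g) 1≤j (∸-monoˡ-≤ 1 j<h)) ⟩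
        x 1 j + x 1 (j + 1)  ≡⟨ sym (adjSum-inner 1 j<n) ⟩
        adjSum 1 j           ∎
        where j<n = <-trans j<h h<n

    even-row : ∀ q j → q < g → 1 ≤ j → j ≤ n → adjSum (suc (suc (q + q))) j + adjSum 1 j ≡ C + C
    even-row q j q<g = complementary-opposite {C} {adjSum e} {adjSum 1}
      (row-complementary e (s≤s z≤n) (even-row-≤ q<g)) (row-complementary 1 ≤-refl 1≤m)
      (cong₂ _+_ (adjSum-last≡C e (s≤s z≤n) (even-row-≤ q<g)) (adjSum-last≡C 1 ≤-refl 1≤m)) below j
      where
      e = suc (suc (q + q))
      below : ∀ j → 1 ≤ j → j < h → adjSum e j + adjSum 1 j ≡ C + C
      below j 1≤j j<h = begin
        adjSum e j + adjSum 1 j         ≡⟨ cong (adjSum e j +_) (sym reflected) ⟩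
        adjSum e j + adjSum e (n ∸ j)   ≡⟨ row-complementary e (s≤s z≤n) (even-row-≤ q<g) j 1≤j j<n ⟩
        C + C                           ∎
        where
        j<n = <-trans j<h h<n
        reflected : adjSum e (n ∸ j) ≡ adjSum 1 j
        reflected = begin
          adjSum e (n ∸ j)               ≡⟨ adjSum-inner e (∸-monoʳ-< 1≤j (<⇒≤ j<n)) ⟩
          x e (n ∸ j) + x e (n ∸ j + 1)  ≡⟨ subst (λ t → x t (n ∸ j) + x t (n ∸ j + 1) ≡ x 1 j + x 1 (j + 1))
                                             (even-index q) (even-adjacent (suc q) j (s≤s z≤n) q<g 1≤j (∸-monoˡ-≤ 1 j<h)) ⟩
          x 1 j + x 1 (j + 1)            ≡⟨ sym (adjSum-inner 1 j<n) ⟩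
          adjSum 1 j                     ∎

    vertical : Vertical (C + C)
    vertical (suc i) j _ i<m 1≤j j≤n =
      alternating-step {r = λ i → adjSum (suc i) j} {B = g + g}
        (λ q q+q≤2g → odd-row q j (double-cancel-≤ q+q≤2g) 1≤j j≤n)
        (λ q q+q<2g → even-row q j (double-cancel-< q+q<2g) 1≤j j≤n)
        i (≤-pred (subst (suc (suc i) ≤_) m≡1+2g i<m))

    twisted : Twisted (C + C)
    twisted j 1≤j j≤n with m≤n⇒m<n∨m≡n j≤n
    ... | inj₁ j<n = begin
      adjSum m j + twistSum j        ≡⟨ cong₂ _+_ last-row (twistSum-inner 1≤j j<n) ⟩
      adjSum 1 j + adjSum 1 (n ∸ j)  ≡⟨ row-complementary 1 ≤-refl 1≤m j 1≤j j<n ⟩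
      C + C                          ∎
      where
      last-row : adjSum m j ≡ adjSum 1 j
      last-row = subst (λ t → adjSum t j ≡ adjSum 1 j) (sym m≡1+2g) (odd-row g j ≤-refl 1≤j j≤n)
    ... | inj₂ refl = cong₂ _+_ (adjSum-last≡C m 1≤m ≤-refl)
      (trans twistSum-last (oppSum≡C 1 1 ≤-refl 1≤m ≤-refl 1≤n))

  faceMagic⇔conditions : Bijective _≡_ _≡_ X → FaceMagic m n X ⇔ Conditions (suc g) g
  faceMagic⇔conditions (_ , surj) = mk⇔
    (λ magic → let (_ , vertical , twisted) = faceMagic⇒ magic in Forward.conditions vertical twisted surj)
    (λ (c₁ , c₂ , c₃ , c₄) → faceMagic⇐ (Backward.vertical c₁ c₂ c₃ c₄) (Backward.twisted c₁ c₂ c₃ c₄))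

*2≡double : ∀ a → a * 2 ≡ a + a
*2≡double a = trans (*-comm a 2) (cong (a +_) (+-identityʳ a))

m%2≡1⇒m≡1+[m/2+m/2] : ∀ {m} → m % 2 ≡ 1 → m ≡ suc (m / 2 + m / 2)
m%2≡1⇒m≡1+[m/2+m/2] {m} m%2≡1 = trans (m≡m%n+[m/n]*n m 2) (cong₂ _+_ m%2≡1 (*2≡double (m / 2)))

m%2≡0⇒m≡m/2+m/2 : ∀ {m} → m % 2 ≡ 0 → m ≡ m / 2 + m / 2
m%2≡0⇒m≡m/2+m/2 {m} m%2≡0 = trans (m≡m%n+[m/n]*n m 2) (cong₂ _+_ m%2≡0 (*2≡double (m / 2)))

lemma4p5 : (m n : ℕ) → 3 ≤ m → m % 2 ≡ 1 → 4 ≤ n → n % 2 ≡ 0 →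
    (X : Fin m × Fin n → Fin (m * n)) → Bijective _≡_ _≡_ X →
    FaceMagic m n X ⇔
      ((∀ i j → 1 ≤ i → i ≤ (m + 1) / 2 → 1 ≤ j → j ≤ n / 2 ∸ 1 →
          lab X (2 * i ∸ 1) j + lab X (2 * i ∸ 1) (j + 1) ≡ lab X 1 j + lab X 1 (j + 1))
       × (∀ i j → 1 ≤ i → i ≤ (m + 1) / 2 → 1 ≤ j → j ≤ n / 2 →
          lab X (2 * i ∸ 1) (n + 1 ∸ j) ≡ (m * n + 1) ∸ lab X (2 * i ∸ 1) j)
       × (∀ i j → 1 ≤ i → i ≤ (m ∸ 1) / 2 → 1 ≤ j → j ≤ n / 2 ∸ 1 →
          lab X (2 * i) (n ∸ j) + lab X (2 * i) (n ∸ j + 1) ≡ lab X 1 j + lab X 1 (j + 1))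
       × (∀ i j → 1 ≤ i → i ≤ (m ∸ 1) / 2 → 1 ≤ j → j ≤ n / 2 →
          lab X (2 * i) j ≡ (m * n + 1) ∸ lab X (2 * i) (n + 1 ∸ j)))
lemma4p5 m n _ m-odd 4≤n n-even X bij =
  subst₂ (λ u v → FaceMagic m n X ⇔ Conditions u v) (sym odd-count) (sym even-count)
    (faceMagic⇔conditions bij)
  where
  g = m / 2
  m≡1+2g = m%2≡1⇒m≡1+[m/2+m/2] m-odd
  n≡h+h = m%2≡0⇒m≡m/2+m/2 n-even
  1≤h = double-cancel-≤ (subst (2 ≤_) n≡h+h (≤-trans (s≤s (s≤s z≤n)) 4≤n))
  open Grid m n g (n / 2) m≡1+2g n≡h+h 1≤h X
  odd-count : (m + 1) / 2 ≡ suc g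
  odd-count = begin
    (m + 1) / 2             ≡⟨ cong (λ t → (t + 1) / 2) m≡1+2g ⟩
    (suc (g + g) + 1) / 2   ≡⟨ cong (_/ 2) (trans (+-comm (suc (g + g)) 1)
                                 (trans (cong suc (sym (+-suc g g))) (sym (*2≡double (suc g))))) ⟩
    suc g * 2 / 2           ≡⟨ m*n/n≡m (suc g) 2 ⟩
    suc g                   ∎
  even-count : (m ∸ 1) / 2 ≡ g
  even-count = trans (cong (λ t → (t ∸ 1) / 2) m≡1+2g) (trans (cong (_/ 2) (sym (*2≡double g))) (m*n/n≡m g 2))
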